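{- Let $\mathbf a$ and $\mathbf b$ be compositions with $\mathbf b\ne\epsilon$. Then $$\mathrm P(\mathbf a\oplus(3)\oplus\mathbf b)=\binom{|\mathbf a|+|\mathbf b|+3}{|\mathbf a|+1}\,\mathrm P(\mathbf a\oplus(1))\,\mathrm P((2)\oplus\mathbf b).$$
   Context: Permutations $\sigma\in\mathcal S_n$ are words $\sigma_1\cdots\sigma_n$; $i$ is a peak if $\sigma_{i-1}<\sigma_i>\sigma_{i+1}$. A composition of $n$ is a finite sequence of positive integers summing to $n$; $|\mathbf c|$ denotes the size (sum of parts); $\epsilon$ is the empty composition, $|\epsilon|=0$. If the peak set of $\sigma\in\mathcal S_n$ is $\{i_1<\dots<i_k\}$, its peak-composition is $(c_1,\dots,c_{k+1})$, $c_j=i_j-i_{j-1}$, $i_0=0$, $i_{k+1}=n$. $\mathrm P(\mathbf c)$ is the number of $\sigma\in\mathcal S_{|\mathbf c|}$ with peak-composition $\mathbf c$. $\oplus$ denotes concatenation, with $\epsilon\oplus\mathbf c=\mathbf c\oplus\epsilon=\mathbf c$. -}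

module Defs where

open import Data.Nat using (ℕ; zero; suc; _∸_; _<?_)
open import Data.Nat.Properties using (_≟_)
open import Data.List using (List; []; _∷_; length; filter; map; concatMap; upTo)
open import Data.Nat.ListAction using (sum)
open import Data.List.Properties using (≡-dec)
open import Data.Bool using (Bool; true; false; _∧_; if_then_else_)
open import Relation.Nullary using (does)
open import Data.List.Relation.Unary.Unique.DecPropositional _≟_ using (unique?)

-- A composition is a list of positive naturals (List ℕ with All (0 <_)),
-- concatenation ⊕ is _++_, the empty composition ε is [], size |c| is sum c.

-- Permutations σ ∈ S_n as words σ₁⋯σₙ: lists of length n over the letters
-- 1..n with pairwise distinct letters.

words : ℕ → ℕ → List (List ℕ)
words n zero    = [] ∷ []
words n (suc k) = concatMap (λ w → map (λ x → x ∷ w) (map suc (upTo n))) (words n k)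

S : ℕ → List (List ℕ)
S n = filter unique? (words n n)

-- peak positions (1-indexed) of a word; the argument i is the position
-- of the second letter of the list given
peaksFrom : ℕ → List ℕ → List ℕ
peaksFrom i (x ∷ y ∷ z ∷ rest) =
  if does (x <? y) ∧ does (z <? y)
  then i ∷ peaksFrom (suc i) (y ∷ z ∷ rest)
  else peaksFrom (suc i) (y ∷ z ∷ rest)
peaksFrom i _ = []

peaks : List ℕ → List ℕ
peaks σ = peaksFrom 2 σ

diffs : ℕ → List ℕ → ℕ → List ℕ
diffs prev []       n = (n ∸ prev) ∷ []
diffs prev (i ∷ is) n = (i ∸ prev) ∷ diffs i is n

-- peak-composition of σ ∈ S_n (for n = 0 the empty word gets ε)
peakComp : List ℕ → List ℕ
peakComp [] = []
peakComp σ@(_ ∷ _) = diffs 0 (peaks σ) (length σ)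

P : List ℕ → ℕ
P c = length (filter (λ σ → ≡-dec _≟_ (peakComp σ) c) (S (sum c)))

module Submission where

-- Put l = |a| + 1 and r = |b| + 2 and cut each σ ∈ S_{l+r} after its l-th
-- letter, σ = L ++ R.  The proof rests on two independent facts.
--
-- (1) Peak splitting (PeakSplit): σ has peak-composition a ⊕ (3) ⊕ b iff L
--     has a ⊕ (1) and R has (2) ⊕ b.  Peak sets are partial sums of
--     peak-compositions; the peaks of σ are those of L, those at the seam
--     (the last letter of L and the first of R) and those of R shifted by l,
--     and the three groups are separated by position.  A ⊕ (1) forces L to
--     end with a descent and (2) ⊕ b forces R to start with an ascent, so
--     there are no seam peaks.
-- (2) Shuffle count (Shuffle): whenever a property Q of words splits in this
--     way into properties Q₁, Q₂ that only depend on the relative order of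
--     letters, σ ↦ (set of letters of L, standardisation of L, of R) is a
--     bijection onto (l-subsets of {1,…,l+r}) × (Q₁-permutations of S_l) ×
--     (Q₂-permutations of S_r); hence the counts multiply with C(l+r, l).
--     Peak-compositions are order invariant (peakComp-invariant).

open import Defs
open import Data.Nat using (ℕ; zero; suc; pred; _+_; _*_; _∸_; _≤_; _<_; z≤n; s≤s; _<?_; _≤?_)
open import Data.Nat.Properties
open import Data.Nat.Combinatorics using (_C_; nCk+nC[k+1]≡[n+1]C[k+1])
open import Data.Nat.ListAction using (sum)
open import Data.Nat.ListAction.Properties using (sum-++)
open import Data.Bool using (Bool; true; false; _∧_)
open import Data.Bool.Properties using (∧-zeroʳ)
open import Data.Unit using (⊤; tt)
open import Data.Empty using (⊥; ⊥-elim)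
open import Data.Product using (_×_; _,_; proj₁; proj₂; ∃-syntax)
open import Data.Sum using (inj₁; inj₂)
open import Data.List using (List; []; _∷_; _++_; length; map; filter; concatMap; upTo; cartesianProduct; cartesianProductWith)
open import Data.List.Properties
  using (length-++; length-map; length-applyUpTo; map-++; ++-assoc; ++-identityʳ; ∷-injective; ∷-injectiveʳ;
         map-injective; map-∘; map-id-local; filter-++; filter-all; filter-none; ≡-dec)
open import Data.List.Membership.Propositional using (_∈_; _∉_)
open import Data.List.Membership.Propositional.Properties
open import Data.List.Membership.DecPropositional _≟_ using (_∈?_)
open import Data.List.Relation.Binary.Subset.Propositional using (_⊆_)
open import Data.List.Relation.Unary.Any using (here; there)
open import Data.List.Relation.Unary.All using (All; []; _∷_; tabulate; lookup) renaming (map to mapAll)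
import Data.List.Relation.Unary.All.Properties as All
open import Data.List.Relation.Unary.AllPairs using ([]; _∷_)
open import Data.List.Relation.Unary.Unique.Propositional using (Unique)
import Data.List.Relation.Unary.Unique.Propositional.Properties as Unique
open import Data.List.Relation.Unary.Unique.DecPropositional _≟_ using (unique?)
open import Function using (_∘′_)
open import Function.Bundles using (_⇔_; mk⇔; Equivalence)
open import Relation.Nullary using (¬_; yes; no; does)
open import Relation.Nullary.Decidable using (dec-true; dec-false)
open import Relation.Unary using (Decidable)
open import Relation.Binary.Definitions using (tri<; tri≈; tri>)
open import Relation.Binary.PropositionalEquality using (_≡_; _≢_; refl; sym; trans; cong; cong₂; subst; module ≡-Reasoning)

⊆-length : ∀ {A : Set} {xs ys : List A} → Unique xs → xs ⊆ ys → length xs ≤ length ys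
⊆-length {xs = []} _ _ = z≤n
⊆-length {xs = x ∷ xs} (x∉xs ∷ u) xs⊆ys with ∈-∃++ (xs⊆ys (here refl))
... | ys₁ , ys₂ , refl = subst (suc (length xs) ≤_) (sym (length-drop ys₁))
        (s≤s (⊆-length u (λ z∈xs → drop-∈ ys₁ (xs⊆ys (there z∈xs)) (λ { refl → lookup x∉xs z∈xs refl }))))
  where
    drop-∈ : ∀ {z} ys₁ → z ∈ ys₁ ++ x ∷ ys₂ → z ≢ x → z ∈ ys₁ ++ ys₂
    drop-∈ []        (here z≡x)  z≢x = ⊥-elim (z≢x z≡x)
    drop-∈ []        (there z∈)  _   = z∈
    drop-∈ (y ∷ ys₁) (here z≡y)  _   = here z≡y
    drop-∈ (y ∷ ys₁) (there z∈)  z≢x = there (drop-∈ ys₁ z∈ z≢x)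
    length-drop : ∀ ys₁ → length (ys₁ ++ x ∷ ys₂) ≡ suc (length (ys₁ ++ ys₂))
    length-drop []        = refl
    length-drop (y ∷ ys₁) = cong suc (length-drop ys₁)

⊆-length-complete : ∀ {xs ys : List ℕ} → Unique xs → xs ⊆ ys → length ys ≤ length xs → ys ⊆ xs
⊆-length-complete {xs} u xs⊆ys |ys|≤|xs| {y} y∈ys with y ∈? xs
... | yes y∈xs = y∈xs
... | no  y∉xs = ⊥-elim (<⇒≱ (⊆-length (All.¬Any⇒All¬ xs y∉xs ∷ u) y∷xs⊆ys) |ys|≤|xs|)
  where
    y∷xs⊆ys : y ∷ xs ⊆ _
    y∷xs⊆ys (here refl) = y∈ys
    y∷xs⊆ys (there z∈)  = xs⊆ys z∈

⊆-antisym-length : ∀ {A : Set} {xs ys : List A} → Unique xs → Unique ys → xs ⊆ ys → ys ⊆ xs → length xs ≡ length ys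
⊆-antisym-length uxs uys xs⊆ys ys⊆xs = ≤-antisym (⊆-length uxs xs⊆ys) (⊆-length uys ys⊆xs)

map-unique : ∀ {A B : Set} (f : A → B) {xs : List A} →
  (∀ {x y} → x ∈ xs → y ∈ xs → f x ≡ f y → x ≡ y) → Unique xs → Unique (map f xs)
map-unique f {[]} _ _ = []
map-unique f {x ∷ xs} inj (x∉xs ∷ u) =
  fresh x∉xs (λ y∈ → there y∈) ∷ map-unique f (λ p q → inj (there p) (there q)) u
  where
    fresh : ∀ {ys} → All (x ≢_) ys → ys ⊆ x ∷ xs → All (f x ≢_) (map f ys)
    fresh []         _   = []
    fresh (x≢y ∷ ps) sub = (λ fx≡fy → x≢y (inj (here refl) (sub (here refl)) fx≡fy)) ∷ fresh ps (sub ∘′ there)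

map-injective-on : ∀ (f : ℕ → ℕ) (P : ℕ → Set) → (∀ {x y} → P x → P y → f x ≡ f y → x ≡ y) →
  ∀ {xs ys} → All P xs → All P ys → map f xs ≡ map f ys → xs ≡ ys
map-injective-on f P inj [] [] _ = refl
map-injective-on f P inj (px ∷ pxs) (py ∷ pys) eq =
  cong₂ _∷_ (inj px py (proj₁ (∷-injective eq))) (map-injective-on f P inj pxs pys (proj₂ (∷-injective eq)))

length-cartesianProductWith : ∀ {A B D : Set} (f : A → B → D) (xs : List A) (ys : List B) →
  length (cartesianProductWith f xs ys) ≡ length xs * length ys
length-cartesianProductWith f []       ys = refl
length-cartesianProductWith f (x ∷ xs) ys =
  trans (length-++ (map (f x) ys)) (cong₂ _+_ (length-map (f x) ys) (length-cartesianProductWith f xs ys))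

++-cancel-≡-length : ∀ {A : Set} (xs ys : List A) {zs ws} →
  length xs ≡ length ys → xs ++ zs ≡ ys ++ ws → xs ≡ ys × zs ≡ ws
++-cancel-≡-length []       []       _ eq = refl , eq
++-cancel-≡-length (x ∷ xs) (y ∷ ys) |xs|≡|ys| eq with ∷-injective eq
... | refl , eq′ with ++-cancel-≡-length xs ys (suc-injective |xs|≡|ys|) eq′
... | xs≡ys , zs≡ws = cong (x ∷_) xs≡ys , zs≡ws

splitAt-length : ∀ l (σ : List ℕ) → l ≤ length σ → ∃[ L ] ∃[ R ] (σ ≡ L ++ R × length L ≡ l)
splitAt-length zero    σ       _         = [] , σ , refl , refl
splitAt-length (suc l) (x ∷ σ) (s≤s l≤) with splitAt-length l σ l≤
... | L , R , refl , |L|≡l = x ∷ L , R , refl , cong suc |L|≡l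

++-unique⁻ : ∀ (L R : List ℕ) → Unique (L ++ R) → Unique L × Unique R × (∀ {z} → z ∈ L → z ∈ R → ⊥)
++-unique⁻ []      R u = [] , u , (λ ())
++-unique⁻ (x ∷ L) R (x∉ ∷ u) with ++-unique⁻ L R u
... | uL , uR , disjoint = All.++⁻ˡ L x∉ ∷ uL , uR , disjoint′
  where
    disjoint′ : ∀ {z} → z ∈ x ∷ L → z ∈ R → ⊥
    disjoint′ (here refl) z∈R = lookup (All.++⁻ʳ L x∉) z∈R refl
    disjoint′ (there z∈L) z∈R = disjoint z∈L z∈R

InRange : ℕ → ℕ → ℕ → Set
InRange k n x = k ≤ x × x < k + n

InRange-suc : ∀ {k n x} → InRange (suc k) n x → InRange k (suc n) x
InRange-suc {k} {n} {x} (k<x , x<) = ≤-trans (n≤1+n k) k<x , subst (x <_) (sym (+-suc k n)) x<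

InRange-here : ∀ k n → InRange k (suc n) k
InRange-here k n = ≤-refl , subst (k <_) (sym (+-suc k n)) (s≤s (m≤m+n k n))

InRange-pred : ∀ {k n x} → InRange k (suc n) x → k ≢ x → InRange (suc k) n x
InRange-pred {k} {n} {x} (k≤x , x<) k≢x = ≤∧≢⇒< k≤x k≢x , subst (x <_) (+-suc k n) x<

InRange-empty : ∀ {k x} → ¬ InRange k 0 x
InRange-empty {k} (k≤x , x<k+0) = <-irrefl refl (≤-trans x<k+0 (subst (_≤ _) (sym (+-identityʳ k)) k≤x))

Letter : ℕ → ℕ → Set
Letter n = InRange 1 n

IsPerm : ℕ → List ℕ → Set
IsPerm n σ = Unique σ × length σ ≡ n × All (Letter n) σ

letters : ℕ → List ℕ
letters n = map suc (upTo n)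

letters-sound : ∀ {n x} → x ∈ letters n → Letter n x
letters-sound x∈ with ∈-map⁻ suc x∈
... | y , y∈ , refl = s≤s z≤n , s≤s (∈-upTo⁻ y∈)

letters-complete : ∀ {n x} → Letter n x → x ∈ letters n
letters-complete {x = suc x} (_ , s≤s x<n) = ∈-map⁺ suc (∈-upTo⁺ x<n)

letters-unique : ∀ n → Unique (letters n)
letters-unique n = Unique.map⁺ suc-injective (Unique.upTo⁺ n)

length-letters : ∀ n → length (letters n) ≡ n
length-letters n = trans (length-map suc (upTo n)) (length-applyUpTo (λ x → x) n)

words-suc : ∀ n k → words n (suc k) ≡ cartesianProductWith (λ w x → x ∷ w) (words n k) (letters n)
words-suc n k = concatMap-as-product (words n k)
  where
    concatMap-as-product : ∀ ws → concatMap (λ (w : List ℕ) → map (λ x → x ∷ w) (letters n)) ws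
                                  ≡ cartesianProductWith (λ w x → x ∷ w) ws (letters n)
    concatMap-as-product []       = refl
    concatMap-as-product (w ∷ ws) = cong (map (λ x → x ∷ w) (letters n) ++_) (concatMap-as-product ws)

words-sound : ∀ n k {w} → w ∈ words n k → length w ≡ k × All (Letter n) w
words-sound n zero    (here refl) = refl , []
words-sound n (suc k) {w} w∈ with ∈-cartesianProductWith⁻ _ (words n k) (letters n) (subst (w ∈_) (words-suc n k) w∈)
... | v , x , v∈ , x∈ , refl with words-sound n k v∈
... | |v|≡k , letters-v = cong suc |v|≡k , letters-sound x∈ ∷ letters-v

words-complete : ∀ n k {w} → length w ≡ k → All (Letter n) w → w ∈ words n k
words-complete n zero    {[]}    _      _          = here refl
words-complete n (suc k) {x ∷ w} |w|≡k (x∈ ∷ w∈) =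
  subst ((x ∷ w) ∈_) (sym (words-suc n k))
    (∈-cartesianProductWith⁺ _ (words-complete n k (suc-injective |w|≡k) w∈) (letters-complete x∈))

words-unique : ∀ n k → Unique (words n k)
words-unique n zero    = [] ∷ []
words-unique n (suc k) = subst Unique (sym (words-suc n k))
  (Unique.cartesianProductWith⁺ _ (λ { refl → refl , refl }) (words-unique n k) (letters-unique n))

S-sound : ∀ n {σ} → σ ∈ S n → IsPerm n σ
S-sound n σ∈ with ∈-filter⁻ unique? σ∈
... | σ∈words , u with words-sound n n σ∈words
... | |σ|≡n , letters-σ = u , |σ|≡n , letters-σ

S-complete : ∀ n {σ} → IsPerm n σ → σ ∈ S n
S-complete n (u , |σ|≡n , letters-σ) = ∈-filter⁺ unique? (words-complete n n |σ|≡n letters-σ) u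

S-unique : ∀ n → Unique (S n)
S-unique n = Unique.filter⁺ unique? (words-unique n n)

-- A permutation of {1,…,n} uses every letter (pigeonhole).
perm-surjective : ∀ n {σ} → IsPerm n σ → ∀ {x} → Letter n x → x ∈ σ
perm-surjective n {σ} (u , |σ|≡n , letters-σ) x =
  ⊆-length-complete u (λ z∈ → letters-complete (lookup letters-σ z∈))
    (subst (_≤ length σ) (sym (length-letters n)) (≤-reflexive (sym |σ|≡n))) (letters-complete x)

-- Subsets of an interval, encoded as 0/1-masks.

#true : List Bool → ℕ
#true []           = 0
#true (true ∷ m)  = suc (#true m)
#true (false ∷ m) = #true m

masks : ℕ → ℕ → List (List Bool)
masks zero    zero    = [] ∷ []
masks zero    (suc l) = []
masks (suc n) zero    = map (false ∷_) (masks n zero)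
masks (suc n) (suc l) = map (true ∷_) (masks n l) ++ map (false ∷_) (masks n (suc l))

masks-sound : ∀ n l {m} → m ∈ masks n l → length m ≡ n × #true m ≡ l
masks-sound zero    zero    (here refl) = refl , refl
masks-sound (suc n) zero    m∈ with ∈-map⁻ (false ∷_) m∈
... | m , m∈′ , refl = let (|m| , #m) = masks-sound n zero m∈′ in cong suc |m| , #m
masks-sound (suc n) (suc l) m∈ with ∈-++⁻ (map (true ∷_) (masks n l)) m∈
... | inj₁ m∈₁ with ∈-map⁻ (true ∷_) m∈₁
...   | m , m∈′ , refl = let (|m| , #m) = masks-sound n l m∈′ in cong suc |m| , cong suc #m
masks-sound (suc n) (suc l) m∈ | inj₂ m∈₂ with ∈-map⁻ (false ∷_) m∈₂
...   | m , m∈′ , refl = let (|m| , #m) = masks-sound n (suc l) m∈′ in cong suc |m| , #m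

masks-complete : ∀ n l m → length m ≡ n → #true m ≡ l → m ∈ masks n l
masks-complete zero    zero    []          refl refl = here refl
masks-complete (suc n) zero    (false ∷ m) |m| #m =
  ∈-map⁺ (false ∷_) (masks-complete n zero m (suc-injective |m|) #m)
masks-complete (suc n) (suc l) (true ∷ m)  |m| #m =
  ∈-++⁺ˡ (∈-map⁺ (true ∷_) (masks-complete n l m (suc-injective |m|) (suc-injective #m)))
masks-complete (suc n) (suc l) (false ∷ m) |m| #m =
  ∈-++⁺ʳ (map (true ∷_) (masks n l)) (∈-map⁺ (false ∷_) (masks-complete n (suc l) m (suc-injective |m|) #m))

masks-unique : ∀ n l → Unique (masks n l)
masks-unique zero    zero    = [] ∷ []
masks-unique zero    (suc l) = []
masks-unique (suc n) zero    = Unique.map⁺ ∷-injectiveʳ (masks-unique n zero)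
masks-unique (suc n) (suc l) =
  Unique.++⁺ (Unique.map⁺ ∷-injectiveʳ (masks-unique n l)) (Unique.map⁺ ∷-injectiveʳ (masks-unique n (suc l))) disjoint
  where
    disjoint : ∀ {v} → ¬ (v ∈ map (true ∷_) (masks n l) × v ∈ map (false ∷_) (masks n (suc l)))
    disjoint (p , q) with ∈-map⁻ (true ∷_) p | ∈-map⁻ (false ∷_) q
    ... | _ , _ , refl | _ , _ , ()

length-masks : ∀ n l → length (masks n l) ≡ n C l
length-masks zero    zero    = refl
length-masks zero    (suc l) = refl
length-masks (suc n) zero    = trans (length-map (false ∷_) (masks n zero)) (length-masks n zero)
length-masks (suc n) (suc l) = begin
    length (map (true ∷_) (masks n l) ++ map (false ∷_) (masks n (suc l)))
  ≡⟨ length-++ (map (true ∷_) (masks n l)) ⟩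
    length (map (true ∷_) (masks n l)) + length (map (false ∷_) (masks n (suc l)))
  ≡⟨ cong₂ _+_ (trans (length-map (true ∷_) (masks n l)) (length-masks n l))
               (trans (length-map (false ∷_) (masks n (suc l))) (length-masks n (suc l))) ⟩
    n C l + n C suc l
  ≡⟨ nCk+nC[k+1]≡[n+1]C[k+1] n l ⟩
    suc n C suc l ∎
  where open ≡-Reasoning

Increasing : List ℕ → Set
Increasing []       = ⊤
Increasing (x ∷ xs) = All (x <_) xs × Increasing xs

-- When the i-th entry of a mask stands for the number k + i, these are the
-- numbers marked `true` (chosen) and `false` (unchosen).
chosen unchosen : ℕ → List Bool → List ℕ
chosen k []           = []
chosen k (true ∷ m)  = k ∷ chosen (suc k) m
chosen k (false ∷ m) = chosen (suc k) m
unchosen k []           = []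
unchosen k (true ∷ m)  = unchosen (suc k) m
unchosen k (false ∷ m) = k ∷ unchosen (suc k) m

chosen-range : ∀ k m {x} → x ∈ chosen k m → InRange k (length m) x
chosen-range k (true ∷ m)  (here refl) = InRange-here k (length m)
chosen-range k (true ∷ m)  (there x∈)  = InRange-suc (chosen-range (suc k) m x∈)
chosen-range k (false ∷ m) x∈          = InRange-suc (chosen-range (suc k) m x∈)

unchosen-range : ∀ k m {x} → x ∈ unchosen k m → InRange k (length m) x
unchosen-range k (false ∷ m) (here refl) = InRange-here k (length m)
unchosen-range k (false ∷ m) (there x∈)  = InRange-suc (unchosen-range (suc k) m x∈)
unchosen-range k (true ∷ m)  x∈          = InRange-suc (unchosen-range (suc k) m x∈)

chosen-increasing : ∀ k m → Increasing (chosen k m)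
chosen-increasing k []          = tt
chosen-increasing k (true ∷ m)  = tabulate (λ x∈ → proj₁ (chosen-range (suc k) m x∈)) , chosen-increasing (suc k) m
chosen-increasing k (false ∷ m) = chosen-increasing (suc k) m

unchosen-increasing : ∀ k m → Increasing (unchosen k m)
unchosen-increasing k []          = tt
unchosen-increasing k (false ∷ m) = tabulate (λ x∈ → proj₁ (unchosen-range (suc k) m x∈)) , unchosen-increasing (suc k) m
unchosen-increasing k (true ∷ m)  = unchosen-increasing (suc k) m

chosen-disjoint : ∀ k m {x} → x ∈ chosen k m → x ∈ unchosen k m → ⊥
chosen-disjoint k (true ∷ m)  (here refl) x∈ = <-irrefl refl (proj₁ (unchosen-range (suc k) m x∈))
chosen-disjoint k (true ∷ m)  (there x∈)  y∈ = chosen-disjoint (suc k) m x∈ y∈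
chosen-disjoint k (false ∷ m) x∈ (here refl) = <-irrefl refl (proj₁ (chosen-range (suc k) m x∈))
chosen-disjoint k (false ∷ m) x∈ (there y∈)  = chosen-disjoint (suc k) m x∈ y∈

length-chosen : ∀ k m → length (chosen k m) ≡ #true m
length-chosen k []          = refl
length-chosen k (true ∷ m)  = cong suc (length-chosen (suc k) m)
length-chosen k (false ∷ m) = length-chosen (suc k) m

length-chosen-unchosen : ∀ k m → length (chosen k m) + length (unchosen k m) ≡ length m
length-chosen-unchosen k []          = refl
length-chosen-unchosen k (true ∷ m)  = cong suc (length-chosen-unchosen (suc k) m)
length-chosen-unchosen k (false ∷ m) =
  trans (+-suc (length (chosen (suc k) m)) _) (cong suc (length-chosen-unchosen (suc k) m))

chosen-injective : ∀ k m m′ → length m ≡ length m′ → chosen k m ≡ chosen k m′ → m ≡ m′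
chosen-injective k []          []           _   _  = refl
chosen-injective k (true ∷ m)  (true ∷ m′)  |m| eq =
  cong (true ∷_) (chosen-injective (suc k) m m′ (suc-injective |m|) (∷-injectiveʳ eq))
chosen-injective k (false ∷ m) (false ∷ m′) |m| eq =
  cong (false ∷_) (chosen-injective (suc k) m m′ (suc-injective |m|) eq)
chosen-injective k (true ∷ m)  (false ∷ m′) _   eq =
  ⊥-elim (<-irrefl refl (proj₁ (chosen-range (suc k) m′ (subst (k ∈_) eq (here refl)))))
chosen-injective k (false ∷ m) (true ∷ m′)  _   eq =
  ⊥-elim (<-irrefl refl (proj₁ (chosen-range (suc k) m (subst (k ∈_) (sym eq) (here refl)))))

interval : ℕ → ℕ → List ℕ
interval k zero    = []
interval k (suc n) = k ∷ interval (suc k) n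

indicator : ℕ → ℕ → List ℕ → List Bool
indicator k n L = map (λ j → does (j ∈? L)) (interval k n)

length-indicator : ∀ k n L → length (indicator k n L) ≡ n
length-indicator k n L = trans (length-map _ (interval k n)) (length-interval k n)
  where
    length-interval : ∀ k n → length (interval k n) ≡ n
    length-interval k zero    = refl
    length-interval k (suc n) = cong suc (length-interval (suc k) n)

chosen-indicator⁻ : ∀ k n L {x} → x ∈ chosen k (indicator k n L) → InRange k n x × x ∈ L
chosen-indicator⁻ k (suc n) L x∈ with k ∈? L
chosen-indicator⁻ k (suc n) L (here refl) | yes k∈L = InRange-here k n , k∈L
chosen-indicator⁻ k (suc n) L (there x∈)  | yes _ = let (r , x∈L) = chosen-indicator⁻ (suc k) n L x∈ in InRange-suc r , x∈L
chosen-indicator⁻ k (suc n) L x∈          | no _  = let (r , x∈L) = chosen-indicator⁻ (suc k) n L x∈ in InRange-suc r , x∈L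

chosen-indicator⁺ : ∀ k n L {x} → InRange k n x → x ∈ L → x ∈ chosen k (indicator k n L)
chosen-indicator⁺ k zero    L r _ = ⊥-elim (InRange-empty r)
chosen-indicator⁺ k (suc n) L {x} r x∈L with k ∈? L | k ≟ x
... | yes _   | yes refl = here refl
... | no  k∉L | yes refl = ⊥-elim (k∉L x∈L)
... | yes _   | no  k≢x  = there (chosen-indicator⁺ (suc k) n L (InRange-pred r k≢x) x∈L)
... | no  _   | no  k≢x  = chosen-indicator⁺ (suc k) n L (InRange-pred r k≢x) x∈L

unchosen-indicator⁻ : ∀ k n L {x} → x ∈ unchosen k (indicator k n L) → InRange k n x × x ∉ L
unchosen-indicator⁻ k (suc n) L x∈ with k ∈? L
unchosen-indicator⁻ k (suc n) L (here refl) | no k∉L = InRange-here k n , k∉L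
unchosen-indicator⁻ k (suc n) L (there x∈)  | no _  = let (r , x∉L) = unchosen-indicator⁻ (suc k) n L x∈ in InRange-suc r , x∉L
unchosen-indicator⁻ k (suc n) L x∈          | yes _ = let (r , x∉L) = unchosen-indicator⁻ (suc k) n L x∈ in InRange-suc r , x∉L

unchosen-indicator⁺ : ∀ k n L {x} → InRange k n x → x ∉ L → x ∈ unchosen k (indicator k n L)
unchosen-indicator⁺ k zero    L r _ = ⊥-elim (InRange-empty r)
unchosen-indicator⁺ k (suc n) L {x} r x∉L with k ∈? L | k ≟ x
... | yes k∈L | yes refl = ⊥-elim (x∉L k∈L)
... | no  _   | yes refl = here refl
... | no  _   | no  k≢x  = there (unchosen-indicator⁺ (suc k) n L (InRange-pred r k≢x) x∉L)
... | yes _   | no  k≢x  = unchosen-indicator⁺ (suc k) n L (InRange-pred r k≢x) x∉L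

OrderPreservingOn : (ℕ → ℕ) → List ℕ → Set
OrderPreservingOn f w = ∀ {x y} → x ∈ w → y ∈ w → x < y → f x < f y

nth : List ℕ → ℕ → ℕ
nth []       _       = 0
nth (x ∷ xs) zero    = x
nth (x ∷ xs) (suc i) = nth xs i

index : List ℕ → ℕ → ℕ
index []       x = 0
index (u ∷ us) x with x ≟ u
... | yes _ = 0
... | no  _ = suc (index us x)

nth-∈ : ∀ U {i} → i < length U → nth U i ∈ U
nth-∈ (x ∷ U) {zero}  _       = here refl
nth-∈ (x ∷ U) {suc i} (s≤s i<) = there (nth-∈ U i<)

nth-index : ∀ U {x} → x ∈ U → nth U (index U x) ≡ x × index U x < length U
nth-index (u ∷ us) {x} x∈ with x ≟ u
... | yes refl = refl , s≤s z≤n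
nth-index (u ∷ us) (here refl) | no x≢u = ⊥-elim (x≢u refl)
nth-index (u ∷ us) (there x∈)  | no _   = let (eq , i<) = nth-index us x∈ in eq , s≤s i<

nth-increasing : ∀ U → Increasing U → ∀ {i j} → i < j → j < length U → nth U i < nth U j
nth-increasing (u ∷ U) (u< , inc) {zero}  {suc j} _        (s≤s j<) = lookup u< (nth-∈ U j<)
nth-increasing (u ∷ U) (u< , inc) {suc i} {suc j} (s≤s i<j) (s≤s j<) = nth-increasing U inc i<j j<

nth-injective : ∀ U → Increasing U → ∀ {i j} → i < length U → j < length U → nth U i ≡ nth U j → i ≡ j
nth-injective U inc {i} {j} i< j< eq with <-cmp i j
... | tri< i<j _ _ = ⊥-elim (<-irrefl eq (nth-increasing U inc i<j j<))
... | tri≈ _ i≡j _ = i≡j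
... | tri> _ _ j<i = ⊥-elim (<-irrefl (sym eq) (nth-increasing U inc j<i i<))

Increasing⇒Unique : ∀ {U} → Increasing U → Unique U
Increasing⇒Unique {[]}    _          = []
Increasing⇒Unique {u ∷ U} (u< , inc) = mapAll (λ u<v u≡v → <-irrefl u≡v u<v) u< ∷ Increasing⇒Unique inc

Increasing-⊆-≡ : ∀ xs ys → Increasing xs → Increasing ys → xs ⊆ ys → ys ⊆ xs → xs ≡ ys
Increasing-⊆-≡ []       []       _ _ _ _ = refl
Increasing-⊆-≡ []       (y ∷ ys) _ _ _ ys⊆ with ys⊆ (here refl)
... | ()
Increasing-⊆-≡ (x ∷ xs) []       _ _ xs⊆ _ with xs⊆ (here refl)
... | ()
Increasing-⊆-≡ (x ∷ xs) (y ∷ ys) (x< , incx) (y< , incy) xs⊆ ys⊆ with x ≟ y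
... | no x≢y = ⊥-elim (heads (xs⊆ (here refl)) (ys⊆ (here refl)))
  where
    heads : x ∈ y ∷ ys → y ∈ x ∷ xs → ⊥
    heads (here x≡y) _          = x≢y x≡y
    heads _          (here y≡x) = x≢y (sym y≡x)
    heads (there x∈) (there y∈) = <-asym (lookup y< x∈) (lookup x< y∈)
... | yes refl = cong (x ∷_) (Increasing-⊆-≡ xs ys incx incy (tails x< xs⊆) (tails y< ys⊆))
  where
    tails : ∀ {us vs} → All (x <_) us → x ∷ us ⊆ x ∷ vs → us ⊆ vs
    tails x<us sub z∈ with sub (there z∈)
    ... | here refl = ⊥-elim (<-irrefl refl (lookup x<us z∈))
    ... | there z∈′ = z∈′

-- relabel U sends the letter t ∈ {1,…,k} to the t-th smallest element of U;
-- for an increasing U of length k it is an order-preserving bijection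
-- {1,…,k} → U.
relabel : List ℕ → ℕ → ℕ
relabel U t = nth U (pred t)

module _ (U : List ℕ) (k : ℕ) (inc : Increasing U) (|U|≡k : length U ≡ k) where

  private
    pred<length : ∀ {t} → Letter k t → pred t < length U
    pred<length {suc t} (_ , s≤s t<k) = subst (t <_) (sym |U|≡k) t<k

  relabel-injective : ∀ {x y} → Letter k x → Letter k y → relabel U x ≡ relabel U y → x ≡ y
  relabel-injective {suc x} {suc y} lx ly eq = cong suc (nth-injective U inc (pred<length lx) (pred<length ly) eq)

  relabel-preserves-order : ∀ τ → All (Letter k) τ → OrderPreservingOn (relabel U) τ
  relabel-preserves-order τ letters-τ {zero}  x∈ _ _ with proj₁ (lookup letters-τ x∈)
  ... | ()
  relabel-preserves-order τ letters-τ {suc x} {suc y} _ y∈ (s≤s x<y) =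
    nth-increasing U inc x<y (pred<length (lookup letters-τ y∈))

  relabel-unique : ∀ {τ} → IsPerm k τ → Unique (map (relabel U) τ)
  relabel-unique (u , _ , letters-τ) =
    map-unique (relabel U) (λ p q → relabel-injective (lookup letters-τ p) (lookup letters-τ q)) u

  relabel-⊆ : ∀ {τ} → All (Letter k) τ → map (relabel U) τ ⊆ U
  relabel-⊆ letters-τ z∈ with ∈-map⁻ (relabel U) z∈
  ... | t , t∈ , refl = nth-∈ U (pred<length (lookup letters-τ t∈))

  relabel-⊇ : ∀ {τ} → IsPerm k τ → U ⊆ map (relabel U) τ
  relabel-⊇ {τ} perm {z} z∈ with nth-index U z∈
  ... | nth≡z , i< = subst (_∈ map (relabel U) τ) nth≡z
        (∈-map⁺ (relabel U) (perm-surjective k perm (s≤s z≤n , s≤s (subst (index U z <_) |U|≡k i<))))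

-- Standardisation: a duplicate-free word L of length k whose letters are
-- exactly the members of an increasing list U is the relabelling by U of a
-- permutation of {1,…,k} (namely of the word of ranks of its letters).
record Standardisation (U L : List ℕ) (k : ℕ) : Set where
  field
    length-U     : length U ≡ k
    word         : List ℕ
    word-perm    : IsPerm k word
    relabel-word : map (relabel U) word ≡ L

standardise : ∀ U L k → Increasing U → Unique L → L ⊆ U → U ⊆ L → length L ≡ k → Standardisation U L k
standardise U L k inc uL L⊆U U⊆L |L|≡k = record
  { length-U = |U|≡k ; word = map rank L ; word-perm = rank-unique , |ranks| , rank-letters ; relabel-word = relabel-rank }
  where
    |U|≡k : length U ≡ k
    |U|≡k = trans (⊆-antisym-length (Increasing⇒Unique inc) uL U⊆L L⊆U) |L|≡k
    rank : ℕ → ℕ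
    rank z = suc (index U z)
    relabel-rank-id : ∀ {z} → z ∈ L → relabel U (rank z) ≡ z
    relabel-rank-id z∈ = proj₁ (nth-index U (L⊆U z∈))
    relabel-rank : map (relabel U) (map rank L) ≡ L
    relabel-rank = trans (sym (map-∘ L)) (map-id-local (tabulate relabel-rank-id))
    rank-unique : Unique (map rank L)
    rank-unique = map-unique rank
      (λ x∈ y∈ eq → trans (sym (relabel-rank-id x∈)) (trans (cong (relabel U) eq) (relabel-rank-id y∈))) uL
    |ranks| : length (map rank L) ≡ k
    |ranks| = trans (length-map rank L) |L|≡k
    rank-letters : All (Letter k) (map rank L)
    rank-letters = All.map⁺ (tabulate (λ z∈ →
      s≤s z≤n , s≤s (subst (index U _ <_) |U|≡k (proj₂ (nth-index U (L⊆U z∈))))))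

-- The shuffle count.

#perms : {Q : List ℕ → Set} → Decidable Q → ℕ → ℕ
#perms Q? n = length (filter Q? (S n))

OrderInvariant : (List ℕ → Set) → Set
OrderInvariant Q = ∀ f w → OrderPreservingOn f w → Q (map f w) ⇔ Q w

SplitsAs : ℕ → ℕ → (Q Q₁ Q₂ : List ℕ → Set) → Set
SplitsAs l r Q Q₁ Q₂ = ∀ L R → length L ≡ l → length R ≡ r → Q (L ++ R) ⇔ (Q₁ L × Q₂ R)

-- If Q splits as order-invariant Q₁ and Q₂, then the permutations of
-- {1,…,l+r} with Q correspond bijectively to triples (m, τ₁, τ₂) of an
-- l-subset m of {1,…,l+r} (the letters of the first l positions), a
-- permutation τ₁ of {1,…,l} with Q₁ and a permutation τ₂ of {1,…,r} with Q₂: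
-- σ = (τ₁ relabelled onto m) ++ (τ₂ relabelled onto the complement of m).
module Shuffle (l r : ℕ) {Q Q₁ Q₂ : List ℕ → Set} (Q? : Decidable Q) (Q₁? : Decidable Q₁) (Q₂? : Decidable Q₂)
               (split : SplitsAs l r Q Q₁ Q₂) (inv₁ : OrderInvariant Q₁) (inv₂ : OrderInvariant Q₂) where

  n : ℕ
  n = l + r

  Triple : Set
  Triple = List Bool × List ℕ × List ℕ

  triples : List Triple
  triples = cartesianProduct (masks n l) (cartesianProduct (filter Q₁? (S l)) (filter Q₂? (S r)))

  shuffle : Triple → List ℕ
  shuffle (m , τ₁ , τ₂) = map (relabel (chosen 1 m)) τ₁ ++ map (relabel (unchosen 1 m)) τ₂

  mask-lengths : ∀ {m} → m ∈ masks n l → length m ≡ n × length (chosen 1 m) ≡ l × length (unchosen 1 m) ≡ r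
  mask-lengths {m} m∈ with masks-sound n l m∈
  ... | |m|≡n , #m≡l = |m|≡n , |U|≡l , +-cancelˡ-≡ l _ _ (trans (cong (_+ length (unchosen 1 m)) (sym |U|≡l))
                                                          (trans (length-chosen-unchosen 1 m) |m|≡n))
    where
      |U|≡l : length (chosen 1 m) ≡ l
      |U|≡l = trans (length-chosen 1 m) #m≡l

  triples⁻ : ∀ {m τ₁ τ₂} → (m , τ₁ , τ₂) ∈ triples → m ∈ masks n l × (τ₁ ∈ S l × Q₁ τ₁) × (τ₂ ∈ S r × Q₂ τ₂)
  triples⁻ t∈ with ∈-cartesianProduct⁻ (masks n l) _ t∈
  ... | m∈ , τ∈ with ∈-cartesianProduct⁻ (filter Q₁? (S l)) _ τ∈
  ... | τ₁∈ , τ₂∈ = m∈ , ∈-filter⁻ Q₁? τ₁∈ , ∈-filter⁻ Q₂? τ₂∈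

  module _ {m} (m∈ : m ∈ masks n l) where
    private
      |m|≡n : length m ≡ n
      |m|≡n = proj₁ (mask-lengths m∈)
      |U|≡l : length (chosen 1 m) ≡ l
      |U|≡l = proj₁ (proj₂ (mask-lengths m∈))
      |V|≡r : length (unchosen 1 m) ≡ r
      |V|≡r = proj₂ (proj₂ (mask-lengths m∈))

    relabel-chosen-⊆ : ∀ {τ₁} → All (Letter l) τ₁ → map (relabel (chosen 1 m)) τ₁ ⊆ chosen 1 m
    relabel-chosen-⊆ = relabel-⊆ (chosen 1 m) l (chosen-increasing 1 m) |U|≡l

    relabel-unchosen-⊆ : ∀ {τ₂} → All (Letter r) τ₂ → map (relabel (unchosen 1 m)) τ₂ ⊆ unchosen 1 m
    relabel-unchosen-⊆ = relabel-⊆ (unchosen 1 m) r (unchosen-increasing 1 m) |V|≡r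

    relabel-chosen-⊇ : ∀ {τ₁} → IsPerm l τ₁ → chosen 1 m ⊆ map (relabel (chosen 1 m)) τ₁
    relabel-chosen-⊇ = relabel-⊇ (chosen 1 m) l (chosen-increasing 1 m) |U|≡l

    relabel-chosen-injective : ∀ {τ₁ τ₁′} → All (Letter l) τ₁ → All (Letter l) τ₁′ →
      map (relabel (chosen 1 m)) τ₁ ≡ map (relabel (chosen 1 m)) τ₁′ → τ₁ ≡ τ₁′
    relabel-chosen-injective = map-injective-on _ (Letter l) (relabel-injective (chosen 1 m) l (chosen-increasing 1 m) |U|≡l)

    relabel-unchosen-injective : ∀ {τ₂ τ₂′} → All (Letter r) τ₂ → All (Letter r) τ₂′ →
      map (relabel (unchosen 1 m)) τ₂ ≡ map (relabel (unchosen 1 m)) τ₂′ → τ₂ ≡ τ₂′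
    relabel-unchosen-injective = map-injective-on _ (Letter r) (relabel-injective (unchosen 1 m) r (unchosen-increasing 1 m) |V|≡r)

    relabel-chosen-Q₁ : ∀ {τ₁} → All (Letter l) τ₁ → Q₁ (map (relabel (chosen 1 m)) τ₁) ⇔ Q₁ τ₁
    relabel-chosen-Q₁ {τ₁} letters-τ₁ =
      inv₁ _ τ₁ (relabel-preserves-order (chosen 1 m) l (chosen-increasing 1 m) |U|≡l τ₁ letters-τ₁)

    relabel-unchosen-Q₂ : ∀ {τ₂} → All (Letter r) τ₂ → Q₂ (map (relabel (unchosen 1 m)) τ₂) ⇔ Q₂ τ₂
    relabel-unchosen-Q₂ {τ₂} letters-τ₂ =
      inv₂ _ τ₂ (relabel-preserves-order (unchosen 1 m) r (unchosen-increasing 1 m) |V|≡r τ₂ letters-τ₂)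

    shuffle-perm : ∀ {τ₁ τ₂} → IsPerm l τ₁ → IsPerm r τ₂ → IsPerm n (shuffle (m , τ₁ , τ₂))
    shuffle-perm {τ₁} {τ₂} p₁@(_ , |τ₁|≡l , letters-τ₁) p₂@(_ , |τ₂|≡r , letters-τ₂) =
      Unique.++⁺ (relabel-unique (chosen 1 m) l (chosen-increasing 1 m) |U|≡l p₁)
                 (relabel-unique (unchosen 1 m) r (unchosen-increasing 1 m) |V|≡r p₂)
                 (λ (x∈₁ , x∈₂) → chosen-disjoint 1 m (relabel-chosen-⊆ letters-τ₁ x∈₁) (relabel-unchosen-⊆ letters-τ₂ x∈₂)) ,
      trans (length-++ (map _ τ₁)) (cong₂ _+_ (trans (length-map _ τ₁) |τ₁|≡l) (trans (length-map _ τ₂) |τ₂|≡r)) ,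
      All.++⁺ (tabulate (λ x∈ → letter (chosen-range 1 m (relabel-chosen-⊆ letters-τ₁ x∈))))
              (tabulate (λ x∈ → letter (unchosen-range 1 m (relabel-unchosen-⊆ letters-τ₂ x∈))))
      where
        letter : ∀ {x} → InRange 1 (length m) x → Letter n x
        letter = subst (λ k → InRange 1 k _) |m|≡n

  shuffle-∈ : ∀ {t} → t ∈ triples → shuffle t ∈ filter Q? (S n)
  shuffle-∈ {m , τ₁ , τ₂} t∈ with triples⁻ t∈
  ... | m∈ , (τ₁∈ , q₁) , (τ₂∈ , q₂) = ∈-filter⁺ Q? (S-complete n (shuffle-perm m∈ p₁ p₂)) q
    where
      p₁ : IsPerm l τ₁
      p₁ = S-sound l τ₁∈
      p₂ : IsPerm r τ₂
      p₂ = S-sound r τ₂∈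
      q : Q (shuffle (m , τ₁ , τ₂))
      q = Equivalence.from
            (split _ _ (trans (length-map _ τ₁) (proj₁ (proj₂ p₁))) (trans (length-map _ τ₂) (proj₁ (proj₂ p₂))))
            (Equivalence.from (relabel-chosen-Q₁ m∈ (proj₂ (proj₂ p₁))) q₁ ,
             Equivalence.from (relabel-unchosen-Q₂ m∈ (proj₂ (proj₂ p₂))) q₂)

  -- a triple is recovered from its shuffle: the first l letters determine
  -- the chosen set, hence the mask, and then τ₁ and τ₂
  shuffle-injective : ∀ {t t′} → t ∈ triples → t′ ∈ triples → shuffle t ≡ shuffle t′ → t ≡ t′
  shuffle-injective {m , τ₁ , τ₂} {m′ , τ₁′ , τ₂′} t∈ t′∈ eq
    with triples⁻ t∈ | triples⁻ t′∈
  ... | m∈ , (τ₁∈ , _) , (τ₂∈ , _) | m′∈ , (τ₁′∈ , _) , (τ₂′∈ , _)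
    with S-sound l τ₁∈ | S-sound r τ₂∈ | S-sound l τ₁′∈ | S-sound r τ₂′∈
  ... | p₁@(_ , |τ₁| , letters₁) | (_ , _ , letters₂) | p₁′@(_ , |τ₁′| , letters₁′) | (_ , _ , letters₂′)
    with ++-cancel-≡-length (map _ τ₁) (map _ τ₁′)
           (trans (length-map _ τ₁) (trans |τ₁| (sym (trans (length-map _ τ₁′) |τ₁′|)))) eq
  ... | eq₁ , eq₂
    with chosen-injective 1 m m′ (trans (proj₁ (mask-lengths m∈)) (sym (proj₁ (mask-lengths m′∈))))
           (Increasing-⊆-≡ (chosen 1 m) (chosen 1 m′) (chosen-increasing 1 m) (chosen-increasing 1 m′)
              (λ z∈ → relabel-chosen-⊆ m′∈ letters₁′ (subst (_ ∈_) eq₁ (relabel-chosen-⊇ m∈ p₁ z∈)))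
              (λ z∈ → relabel-chosen-⊆ m∈ letters₁ (subst (_ ∈_) (sym eq₁) (relabel-chosen-⊇ m′∈ p₁′ z∈))))
  ... | refl = cong₂ (λ τ₁ τ₂ → m , τ₁ , τ₂) (relabel-chosen-injective m∈ letters₁ letters₁′ eq₁)
                                             (relabel-unchosen-injective m∈ letters₂ letters₂′ eq₂)

  module _ {L R} (perm : IsPerm n (L ++ R)) where
    private
      disjoint : ∀ {z} → z ∈ L → z ∈ R → ⊥
      disjoint = proj₂ (proj₂ (++-unique⁻ L R (proj₁ perm)))
      letter : ∀ {z} → z ∈ L ++ R → Letter n z
      letter = lookup (proj₂ (proj₂ perm))

    indicator-⊇L : L ⊆ chosen 1 (indicator 1 n L)
    indicator-⊇L z∈L = chosen-indicator⁺ 1 n L (letter (∈-++⁺ˡ z∈L)) z∈L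

    indicator-⊆L : chosen 1 (indicator 1 n L) ⊆ L
    indicator-⊆L z∈ = proj₂ (chosen-indicator⁻ 1 n L z∈)

    indicator-⊇R : R ⊆ unchosen 1 (indicator 1 n L)
    indicator-⊇R z∈R = unchosen-indicator⁺ 1 n L (letter (∈-++⁺ʳ L z∈R)) (λ z∈L → disjoint z∈L z∈R)

    indicator-⊆R : unchosen 1 (indicator 1 n L) ⊆ R
    indicator-⊆R z∈ with unchosen-indicator⁻ 1 n L z∈
    ... | z-letter , z∉L with ∈-++⁻ L (perm-surjective n perm z-letter)
    ...   | inj₁ z∈L = ⊥-elim (z∉L z∈L)
    ...   | inj₂ z∈R = z∈R

  -- every permutation with Q is a shuffle: take the indicator mask of its
  -- first l letters and standardise both parts
  shuffle-surjective : ∀ {σ} → σ ∈ filter Q? (S n) → σ ∈ map shuffle triples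
  shuffle-surjective {σ} σ∈ with ∈-filter⁻ Q? σ∈
  ... | σ∈S , qσ with S-sound n σ∈S
  ... | perm@(uσ , |σ|≡n , _) with splitAt-length l σ (subst (l ≤_) (sym |σ|≡n) (m≤m+n l r))
  ... | L , R , refl , |L|≡l =
    subst (_∈ map shuffle triples) (cong₂ _++_ relabel-τ₁ relabel-τ₂) (∈-map⁺ shuffle t∈)
    where
      |R|≡r : length R ≡ r
      |R|≡r = +-cancelˡ-≡ l _ _ (trans (cong (_+ length R) (sym |L|≡l)) (trans (sym (length-++ L)) |σ|≡n))
      m : List Bool
      m = indicator 1 n L
      q₁q₂ : Q₁ L × Q₂ R
      q₁q₂ = Equivalence.to (split L R |L|≡l |R|≡r) qσ
      std₁ : Standardisation (chosen 1 m) L l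
      std₁ = standardise (chosen 1 m) L l (chosen-increasing 1 m) (proj₁ (++-unique⁻ L R uσ))
               (indicator-⊇L perm) (indicator-⊆L perm) |L|≡l
      std₂ : Standardisation (unchosen 1 m) R r
      std₂ = standardise (unchosen 1 m) R r (unchosen-increasing 1 m) (proj₁ (proj₂ (++-unique⁻ L R uσ)))
               (indicator-⊇R perm) (indicator-⊆R perm) |R|≡r
      open Standardisation std₁ using () renaming (word to τ₁; word-perm to p₁; relabel-word to relabel-τ₁)
      open Standardisation std₂ using () renaming (word to τ₂; word-perm to p₂; relabel-word to relabel-τ₂)
      m∈ : m ∈ masks n l
      m∈ = masks-complete n l m (length-indicator 1 n L) (trans (sym (length-chosen 1 m)) (Standardisation.length-U std₁))
      q₁ : Q₁ τ₁
      q₁ = Equivalence.to (relabel-chosen-Q₁ m∈ (proj₂ (proj₂ p₁))) (subst Q₁ (sym relabel-τ₁) (proj₁ q₁q₂))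
      q₂ : Q₂ τ₂
      q₂ = Equivalence.to (relabel-unchosen-Q₂ m∈ (proj₂ (proj₂ p₂))) (subst Q₂ (sym relabel-τ₂) (proj₂ q₁q₂))
      t∈ : (m , τ₁ , τ₂) ∈ triples
      t∈ = ∈-cartesianProduct⁺ m∈
             (∈-cartesianProduct⁺ (∈-filter⁺ Q₁? (S-complete l p₁) q₁) (∈-filter⁺ Q₂? (S-complete r p₂) q₂))

  triples-unique : Unique triples
  triples-unique = Unique.cartesianProduct⁺ (masks-unique n l)
                     (Unique.cartesianProduct⁺ (Unique.filter⁺ Q₁? (S-unique l)) (Unique.filter⁺ Q₂? (S-unique r)))

  shuffle-count : #perms Q? n ≡ (n C l) * #perms Q₁? l * #perms Q₂? r
  shuffle-count = begin
      length (filter Q? (S n))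
    ≡⟨ ⊆-antisym-length (Unique.filter⁺ Q? (S-unique n)) (map-unique shuffle (λ p q → shuffle-injective p q) triples-unique)
                        shuffle-surjective shuffle-image ⟩
      length (map shuffle triples)
    ≡⟨ length-map shuffle triples ⟩
      length triples
    ≡⟨ length-cartesianProductWith _,_ (masks n l) _ ⟩
      length (masks n l) * length (cartesianProduct (filter Q₁? (S l)) (filter Q₂? (S r)))
    ≡⟨ cong₂ _*_ (length-masks n l) (length-cartesianProductWith _,_ (filter Q₁? (S l)) _) ⟩
      (n C l) * (#perms Q₁? l * #perms Q₂? r)
    ≡⟨ sym (*-assoc (n C l) _ _) ⟩
      (n C l) * #perms Q₁? l * #perms Q₂? r ∎
    where
      open ≡-Reasoning
      shuffle-image : map shuffle triples ⊆ filter Q? (S n)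
      shuffle-image σ∈ with ∈-map⁻ shuffle σ∈
      ... | t , t∈ , refl = shuffle-∈ t∈

isPeak : ℕ → ℕ → ℕ → Bool
isPeak x y z = does (x <? y) ∧ does (z <? y)

markIf : ℕ → Bool → List ℕ
markIf i true  = i ∷ []
markIf i false = []

markIf-∈ : ∀ {m i b} → m ∈ markIf i b → m ≡ i
markIf-∈ {b = true} (here m≡i) = m≡i

peaksFrom-step : ∀ i x y z rest →
  peaksFrom i (x ∷ y ∷ z ∷ rest) ≡ markIf i (isPeak x y z) ++ peaksFrom (suc i) (y ∷ z ∷ rest)
peaksFrom-step i x y z rest with isPeak x y z
... | true  = refl
... | false = refl

peaksFrom-shift : ∀ k i w → peaksFrom (k + i) w ≡ map (k +_) (peaksFrom i w)
peaksFrom-shift k i (x ∷ y ∷ z ∷ rest) = begin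
    peaksFrom (k + i) (x ∷ y ∷ z ∷ rest)
  ≡⟨ peaksFrom-step (k + i) x y z rest ⟩
    markIf (k + i) (isPeak x y z) ++ peaksFrom (suc (k + i)) (y ∷ z ∷ rest)
  ≡⟨ cong₂ _++_ (markIf-shift (isPeak x y z))
               (trans (cong (λ j → peaksFrom j (y ∷ z ∷ rest)) (sym (+-suc k i))) (peaksFrom-shift k (suc i) (y ∷ z ∷ rest))) ⟩
    map (k +_) (markIf i (isPeak x y z)) ++ map (k +_) (peaksFrom (suc i) (y ∷ z ∷ rest))
  ≡⟨ sym (map-++ (k +_) (markIf i (isPeak x y z)) _) ⟩
    map (k +_) (markIf i (isPeak x y z) ++ peaksFrom (suc i) (y ∷ z ∷ rest))
  ≡⟨ cong (map (k +_)) (sym (peaksFrom-step i x y z rest)) ⟩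
    map (k +_) (peaksFrom i (x ∷ y ∷ z ∷ rest)) ∎
  where
    open ≡-Reasoning
    markIf-shift : ∀ b → markIf (k + i) b ≡ map (k +_) (markIf i b)
    markIf-shift true  = refl
    markIf-shift false = refl
peaksFrom-shift k i []          = refl
peaksFrom-shift k i (x ∷ [])     = refl
peaksFrom-shift k i (x ∷ y ∷ []) = refl

-- Order-preserving relabelling does not change comparisons, hence nor
-- peaks, nor the peak-composition.
<-preserved : ∀ f w → OrderPreservingOn f w → ∀ {x y} → x ∈ w → y ∈ w → does (f x <? f y) ≡ does (x <? y)
<-preserved f w pres {x} {y} x∈ y∈ with <-cmp x y
... | tri< x<y _ _ = trans (dec-true (f x <? f y) (pres x∈ y∈ x<y)) (sym (dec-true (x <? y) x<y))
... | tri≈ _ refl _ = trans (dec-false (f x <? f x) (<-irrefl refl)) (sym (dec-false (x <? x) (<-irrefl refl)))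
... | tri> _ _ y<x = trans (dec-false (f x <? f y) (<⇒≯ (pres y∈ x∈ y<x))) (sym (dec-false (x <? y) (<⇒≯ y<x)))

peaksFrom-invariant : ∀ f i w → OrderPreservingOn f w → peaksFrom i (map f w) ≡ peaksFrom i w
peaksFrom-invariant f i (x ∷ y ∷ z ∷ rest) pres = begin
    peaksFrom i (f x ∷ f y ∷ f z ∷ map f rest)
  ≡⟨ peaksFrom-step i (f x) (f y) (f z) (map f rest) ⟩
    markIf i (isPeak (f x) (f y) (f z)) ++ peaksFrom (suc i) (map f (y ∷ z ∷ rest))
  ≡⟨ cong₂ _++_ (cong (markIf i) (cong₂ _∧_ (<-preserved f _ pres (here refl) (there (here refl)))
                                            (<-preserved f _ pres (there (there (here refl))) (there (here refl)))))
                (peaksFrom-invariant f (suc i) (y ∷ z ∷ rest) (λ p q → pres (there p) (there q))) ⟩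
    markIf i (isPeak x y z) ++ peaksFrom (suc i) (y ∷ z ∷ rest)
  ≡⟨ sym (peaksFrom-step i x y z rest) ⟩
    peaksFrom i (x ∷ y ∷ z ∷ rest) ∎
  where open ≡-Reasoning
peaksFrom-invariant f i []          _ = refl
peaksFrom-invariant f i (x ∷ [])     _ = refl
peaksFrom-invariant f i (x ∷ y ∷ []) _ = refl

peakComp-map : ∀ f w → OrderPreservingOn f w → peakComp (map f w) ≡ peakComp w
peakComp-map f []      _    = refl
peakComp-map f (x ∷ w) pres = cong₂ (diffs 0) (peaksFrom-invariant f 2 (x ∷ w) pres) (cong suc (length-map f w))

peakComp-invariant : ∀ c → OrderInvariant (λ σ → peakComp σ ≡ c)
peakComp-invariant c f w pres = mk⇔ (trans (sym (peakComp-map f w pres))) (trans (peakComp-map f w pres))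

PeakRange : ℕ → ℕ → ℕ → Set
PeakRange i n m = i ≤ m × 3 + m ≤ n + i

peaksFrom-bounds : ∀ i w → All (PeakRange i (length w)) (peaksFrom i w)
peaksFrom-bounds i (x ∷ y ∷ z ∷ rest) = subst (All (PeakRange i (3 + length rest))) (sym (peaksFrom-step i x y z rest))
  (All.++⁺ (first (isPeak x y z)) (mapAll later (peaksFrom-bounds (suc i) (y ∷ z ∷ rest))))
  where
    first : ∀ b → All (PeakRange i (3 + length rest)) (markIf i b)
    first true  = (≤-refl , s≤s (s≤s (s≤s (m≤n+m i (length rest))))) ∷ []
    first false = []
    later : ∀ {m} → PeakRange (suc i) (2 + length rest) m → PeakRange i (3 + length rest) m
    later {m} (i<m , m+3≤) = ≤-trans (n≤1+n i) i<m , subst (3 + m ≤_) (+-suc (2 + length rest) i) m+3≤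
peaksFrom-bounds i []          = []
peaksFrom-bounds i (x ∷ [])     = []
peaksFrom-bounds i (x ∷ y ∷ []) = []

-- The peaks of L ++ r₁ ∷ r₂ ∷ R that sit at the last letter of L or at r₁.
seamPeaks : ℕ → List ℕ → ℕ → ℕ → List ℕ
seamPeaks i []               r₁ r₂ = []
seamPeaks i (x ∷ [])         r₁ r₂ = markIf i (isPeak x r₁ r₂)
seamPeaks i (x ∷ y ∷ [])     r₁ r₂ = markIf i (isPeak x y r₁) ++ markIf (suc i) (isPeak y r₁ r₂)
seamPeaks i (x ∷ y ∷ z ∷ L) r₁ r₂ = seamPeaks (suc i) (y ∷ z ∷ L) r₁ r₂

peaksFrom-++ : ∀ i L r₁ r₂ R → peaksFrom i (L ++ r₁ ∷ r₂ ∷ R)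
  ≡ peaksFrom i L ++ seamPeaks i L r₁ r₂ ++ peaksFrom (length L + i) (r₁ ∷ r₂ ∷ R)
peaksFrom-++ i []           r₁ r₂ R = refl
peaksFrom-++ i (x ∷ [])     r₁ r₂ R = peaksFrom-step i x r₁ r₂ R
peaksFrom-++ i (x ∷ y ∷ []) r₁ r₂ R = begin
    peaksFrom i (x ∷ y ∷ r₁ ∷ r₂ ∷ R)
  ≡⟨ peaksFrom-step i x y r₁ (r₂ ∷ R) ⟩
    markIf i (isPeak x y r₁) ++ peaksFrom (suc i) (y ∷ r₁ ∷ r₂ ∷ R)
  ≡⟨ cong (markIf i (isPeak x y r₁) ++_) (peaksFrom-step (suc i) y r₁ r₂ R) ⟩
    markIf i (isPeak x y r₁) ++ (markIf (suc i) (isPeak y r₁ r₂) ++ peaksFrom (2 + i) (r₁ ∷ r₂ ∷ R))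
  ≡⟨ sym (++-assoc (markIf i (isPeak x y r₁)) _ _) ⟩
    (markIf i (isPeak x y r₁) ++ markIf (suc i) (isPeak y r₁ r₂)) ++ peaksFrom (2 + i) (r₁ ∷ r₂ ∷ R) ∎
  where open ≡-Reasoning
peaksFrom-++ i (x ∷ y ∷ z ∷ L) r₁ r₂ R = begin
    peaksFrom i (x ∷ y ∷ z ∷ (L ++ r₁ ∷ r₂ ∷ R))
  ≡⟨ peaksFrom-step i x y z (L ++ r₁ ∷ r₂ ∷ R) ⟩
    first ++ peaksFrom (suc i) ((y ∷ z ∷ L) ++ r₁ ∷ r₂ ∷ R)
  ≡⟨ cong (first ++_) (peaksFrom-++ (suc i) (y ∷ z ∷ L) r₁ r₂ R) ⟩
    first ++ (peaksFrom (suc i) (y ∷ z ∷ L) ++ seam ++ peaksFrom (length (y ∷ z ∷ L) + suc i) (r₁ ∷ r₂ ∷ R))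
  ≡⟨ sym (++-assoc first _ _) ⟩
    (first ++ peaksFrom (suc i) (y ∷ z ∷ L)) ++ seam ++ peaksFrom (length (y ∷ z ∷ L) + suc i) (r₁ ∷ r₂ ∷ R)
  ≡⟨ cong₂ (λ ps j → ps ++ seam ++ peaksFrom j (r₁ ∷ r₂ ∷ R))
           (sym (peaksFrom-step i x y z L)) (+-suc (length (y ∷ z ∷ L)) i) ⟩
    peaksFrom i (x ∷ y ∷ z ∷ L) ++ seam ++ peaksFrom (length (x ∷ y ∷ z ∷ L) + i) (r₁ ∷ r₂ ∷ R) ∎
  where
    open ≡-Reasoning
    first = markIf i (isPeak x y z)
    seam  = seamPeaks (suc i) (y ∷ z ∷ L) r₁ r₂

seamPeaks-bounds : ∀ i L r₁ r₂ {m} → m ∈ seamPeaks i L r₁ r₂ → length L + i ≤ 2 + m × m < length L + i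
seamPeaks-bounds i (x ∷ []) r₁ r₂ m∈ with markIf-∈ m∈
... | refl = s≤s (n≤1+n i) , ≤-refl
seamPeaks-bounds i (x ∷ y ∷ []) r₁ r₂ m∈ with ∈-++⁻ (markIf i (isPeak x y r₁)) m∈
... | inj₁ m∈₁ with markIf-∈ m∈₁
...   | refl = ≤-refl , s≤s (n≤1+n i)
seamPeaks-bounds i (x ∷ y ∷ []) r₁ r₂ m∈ | inj₂ m∈₂ with markIf-∈ m∈₂
...   | refl = s≤s (n≤1+n (suc i)) , ≤-refl
seamPeaks-bounds i (x ∷ y ∷ z ∷ L) r₁ r₂ {m} m∈ with seamPeaks-bounds (suc i) (y ∷ z ∷ L) r₁ r₂ m∈
... | lower , upper = subst (_≤ 2 + m) (+-suc (length (y ∷ z ∷ L)) i) lower ,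
                      subst (m <_) (+-suc (length (y ∷ z ∷ L)) i) upper

-- w ends with a descent (a single letter counts as such)
EndsDescending : List ℕ → Set
EndsDescending []               = ⊥
EndsDescending (x ∷ [])         = ⊤
EndsDescending (x ∷ y ∷ [])     = y < x
EndsDescending (x ∷ y ∷ z ∷ L) = EndsDescending (y ∷ z ∷ L)

isPeak-no-left : ∀ x y z → ¬ x < y → isPeak x y z ≡ false
isPeak-no-left x y z x≮y = cong (_∧ does (z <? y)) (dec-false (x <? y) x≮y)

isPeak-no-right : ∀ x y z → ¬ z < y → isPeak x y z ≡ false
isPeak-no-right x y z z≮y = trans (cong (does (x <? y) ∧_) (dec-false (z <? y) z≮y)) (∧-zeroʳ _)

seamPeaks-empty : ∀ i L r₁ r₂ → EndsDescending L → r₁ < r₂ → seamPeaks i L r₁ r₂ ≡ []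
seamPeaks-empty i (x ∷ []) r₁ r₂ _ r₁<r₂ = cong (markIf i) (isPeak-no-right x r₁ r₂ (<⇒≯ r₁<r₂))
seamPeaks-empty i (x ∷ y ∷ []) r₁ r₂ y<x r₁<r₂ =
  cong₂ _++_ (cong (markIf i) (isPeak-no-left x y r₁ (<⇒≯ y<x)))
             (cong (markIf (suc i)) (isPeak-no-right y r₁ r₂ (<⇒≯ r₁<r₂)))
seamPeaks-empty i (x ∷ y ∷ z ∷ L) r₁ r₂ desc r₁<r₂ = seamPeaks-empty (suc i) (y ∷ z ∷ L) r₁ r₂ desc r₁<r₂

∈-markIf-++ : ∀ {m i b} ys → m ∈ markIf i b ++ ys → m ≢ i → m ∈ ys
∈-markIf-++ {b = true}  ys (here m≡i) m≢i = ⊥-elim (m≢i m≡i)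
∈-markIf-++ {b = true}  ys (there m∈) _   = m∈
∈-markIf-++ {b = false} ys m∈         _   = m∈

lastPeak⇒EndsDescending : ∀ i w {m} → m ∈ peaksFrom i w → length w + i ≡ 3 + m → EndsDescending w
lastPeak⇒EndsDescending i (x ∷ y ∷ z ∷ []) {m} m∈ _ with z <? y
... | yes z<y = z<y
... | no  z≮y
  with subst (m ∈_) (trans (peaksFrom-step i x y z []) (cong (λ b → markIf i b ++ []) (isPeak-no-right x y z z≮y))) m∈
...   | ()
lastPeak⇒EndsDescending i (x ∷ y ∷ z ∷ w ∷ rest) {m} m∈ |w|+i≡3+m =
  lastPeak⇒EndsDescending (suc i) (y ∷ z ∷ w ∷ rest)
    (∈-markIf-++ _ (subst (m ∈_) (peaksFrom-step i x y z (w ∷ rest)) m∈) m≢i)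
    (trans (+-suc (length (y ∷ z ∷ w ∷ rest)) i) |w|+i≡3+m)
  where
    m≢i : m ≢ i
    m≢i refl with +-cancelʳ-≡ i (length (x ∷ y ∷ z ∷ w ∷ rest)) 3 |w|+i≡3+m
    ... | ()

-- Compositions as sets of partial sums.

-- the partial sums k + c₁, k + c₁ + c₂, …, omitting the total; for k = 0
-- these are the peak positions encoded by the peak-composition c
partialSums : ℕ → List ℕ → List ℕ
partialSums k []           = []
partialSums k (c ∷ [])     = []
partialSums k (c ∷ d ∷ ds) = (k + c) ∷ partialSums (k + c) (d ∷ ds)

partialSums-cons : ∀ k c ds → ds ≢ [] → partialSums k (c ∷ ds) ≡ (k + c) ∷ partialSums (k + c) ds
partialSums-cons k c []      ds≢[] = ⊥-elim (ds≢[] refl)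
partialSums-cons k c (_ ∷ _) _     = refl

∷≢[] : ∀ {x : ℕ} {xs : List ℕ} → x ∷ xs ≢ []
∷≢[] ()

++-∷≢[] : ∀ (a : List ℕ) {x xs} → a ++ x ∷ xs ≢ []
++-∷≢[] []      ()
++-∷≢[] (_ ∷ _) ()

partialSums-split : ∀ k a x y d b → partialSums k (a ++ (x + y) ∷ d ∷ b)
  ≡ partialSums k (a ++ x ∷ []) ++ partialSums (k + sum a + x) (y ∷ d ∷ b)
partialSums-split k []      x y d b = cong (λ j → j ∷ partialSums j (d ∷ b)) (begin
    k + (x + y)     ≡⟨ sym (+-assoc k x y) ⟩
    k + x + y       ≡⟨ cong (λ j → j + x + y) (sym (+-identityʳ k)) ⟩
    k + 0 + x + y   ∎)
  where open ≡-Reasoning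
partialSums-split k (c ∷ a) x y d b = begin
    partialSums k (c ∷ (a ++ (x + y) ∷ d ∷ b))
  ≡⟨ partialSums-cons k c _ (++-∷≢[] a) ⟩
    (k + c) ∷ partialSums (k + c) (a ++ (x + y) ∷ d ∷ b)
  ≡⟨ cong ((k + c) ∷_) (partialSums-split (k + c) a x y d b) ⟩
    (k + c) ∷ (partialSums (k + c) (a ++ x ∷ []) ++ partialSums (k + c + sum a + x) (y ∷ d ∷ b))
  ≡⟨ cong₂ (λ ps j → ps ++ partialSums (j + x) (y ∷ d ∷ b)) (sym (partialSums-cons k c _ (++-∷≢[] a))) (+-assoc k c (sum a)) ⟩
    partialSums k (c ∷ (a ++ x ∷ [])) ++ partialSums (k + (c + sum a) + x) (y ∷ d ∷ b) ∎
  where open ≡-Reasoning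

partialSums-shift : ∀ k m cs → partialSums (k + m) cs ≡ map (k +_) (partialSums m cs)
partialSums-shift k m []           = refl
partialSums-shift k m (c ∷ [])     = refl
partialSums-shift k m (c ∷ d ∷ ds) =
  cong₂ _∷_ (+-assoc k m c) (trans (cong (λ j → partialSums j (d ∷ ds)) (+-assoc k m c)) (partialSums-shift k (m + c) (d ∷ ds)))

partialSums-< : ∀ k cs → All (0 <_) cs → ∀ {m} → m ∈ partialSums k cs → m < k + sum cs
partialSums-< k (c ∷ d ∷ ds) (_ ∷ 0<d ∷ _) (here refl) =
  subst (k + c <_) (+-assoc k c _) (m<m+n (k + c) (<-≤-trans 0<d (m≤m+n d (sum ds))))
partialSums-< k (c ∷ d ∷ ds) (_ ∷ pos) {m} (there m∈) =
  subst (m <_) (+-assoc k c _) (partialSums-< (k + c) (d ∷ ds) pos m∈)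

partialSums-≥ : ∀ k c cs {m} → m ∈ partialSums k (c ∷ cs) → k + c ≤ m
partialSums-≥ k c (d ∷ ds) (here refl) = ≤-refl
partialSums-≥ k c (d ∷ ds) (there m∈)  = ≤-trans (m≤m+n (k + c) d) (partialSums-≥ (k + c) d ds m∈)

partialSums-last : ∀ k c a x → k + sum (c ∷ a) ∈ partialSums k (c ∷ a ++ x ∷ [])
partialSums-last k c []      x = here (cong (k +_) (+-identityʳ c))
partialSums-last k c (d ∷ a) x =
  there (subst (_∈ partialSums (k + c) (d ∷ a ++ x ∷ [])) (+-assoc k c _) (partialSums-last (k + c) d a x))

Chain : ℕ → List ℕ → ℕ → Set
Chain prev []       n = prev ≤ n
Chain prev (i ∷ is) n = prev ≤ i × Chain i is n

diffs⇒partialSums : ∀ prev ps n → Chain prev ps n →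
  ps ≡ partialSums prev (diffs prev ps n) × n ≡ prev + sum (diffs prev ps n)
diffs⇒partialSums prev [] n prev≤n = refl , sym (trans (cong (prev +_) (+-identityʳ (n ∸ prev))) (m+[n∸m]≡n prev≤n))
diffs⇒partialSums prev (i ∷ is) n (prev≤i , chain) with diffs⇒partialSums i is n chain
... | is≡ , n≡ =
  trans (cong₂ _∷_ (sym prev+[i∸prev]≡i) (trans is≡ (cong (λ j → partialSums j (diffs i is n)) (sym prev+[i∸prev]≡i))))
        (sym (partialSums-cons prev (i ∸ prev) (diffs i is n) (diffs≢[] is))) ,
  trans n≡ (trans (cong (_+ sum (diffs i is n)) (sym prev+[i∸prev]≡i)) (+-assoc prev (i ∸ prev) _))
  where
    prev+[i∸prev]≡i : prev + (i ∸ prev) ≡ i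
    prev+[i∸prev]≡i = m+[n∸m]≡n prev≤i
    diffs≢[] : ∀ is → diffs i is n ≢ []
    diffs≢[] []      ()
    diffs≢[] (_ ∷ _) ()

partialSums⇒diffs : ∀ prev c → c ≢ [] → diffs prev (partialSums prev c) (prev + sum c) ≡ c
partialSums⇒diffs prev []           c≢[] = ⊥-elim (c≢[] refl)
partialSums⇒diffs prev (c ∷ [])     _    = cong (_∷ []) (trans (cong (λ j → prev + j ∸ prev) (+-identityʳ c)) (m+n∸m≡n prev c))
partialSums⇒diffs prev (c ∷ d ∷ ds) _    = cong₂ _∷_ (m+n∸m≡n prev c)
  (trans (cong (diffs (prev + c) (partialSums (prev + c) (d ∷ ds))) (sym (+-assoc prev c _)))
         (partialSums⇒diffs (prev + c) (d ∷ ds) ∷≢[]))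

markIf-chain : ∀ prev i ps N b → prev ≤ i → Chain i ps N → Chain prev ps N → Chain prev (markIf i b ++ ps) N
markIf-chain prev i ps N true  prev≤i chain-i _          = prev≤i , chain-i
markIf-chain prev i ps N false _     _       chain-prev = chain-prev

peaksFrom-chain : ∀ prev i w N → prev ≤ i → prev ≤ N → length w + i ≤ N + 3 → Chain prev (peaksFrom i w) N
peaksFrom-chain prev i (x ∷ y ∷ z ∷ rest) N prev≤i prev≤N |w|+i≤ =
  subst (λ ps → Chain prev ps N) (sym (peaksFrom-step i x y z rest))
    (markIf-chain prev i _ N (isPeak x y z) prev≤i
       (peaksFrom-chain i (suc i) (y ∷ z ∷ rest) N (n≤1+n i) i≤N |w′|+i≤)
       (peaksFrom-chain prev (suc i) (y ∷ z ∷ rest) N (≤-trans prev≤i (n≤1+n i)) prev≤N |w′|+i≤))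
  where
    |w′|+i≤ : length (y ∷ z ∷ rest) + suc i ≤ N + 3
    |w′|+i≤ = subst (_≤ N + 3) (sym (+-suc (length (y ∷ z ∷ rest)) i)) |w|+i≤
    i≤N : i ≤ N
    i≤N = +-cancelʳ-≤ 3 i N (subst (_≤ N + 3) (+-comm 3 i) (≤-trans (s≤s (s≤s (s≤s (m≤n+m i (length rest))))) |w|+i≤))
peaksFrom-chain prev i []           N _ prev≤N _ = prev≤N
peaksFrom-chain prev i (x ∷ [])     N _ prev≤N _ = prev≤N
peaksFrom-chain prev i (x ∷ y ∷ []) N _ prev≤N _ = prev≤N

peakComp⇒partialSums : ∀ x σ c → peakComp (x ∷ σ) ≡ c → peaks (x ∷ σ) ≡ partialSums 0 c × length (x ∷ σ) ≡ sum c
peakComp⇒partialSums x σ c refl = diffs⇒partialSums 0 (peaks (x ∷ σ)) (length (x ∷ σ))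
  (peaksFrom-chain 0 2 (x ∷ σ) (length (x ∷ σ)) z≤n z≤n (+-monoʳ-≤ (length (x ∷ σ)) (n≤1+n 2)))

partialSums⇒peakComp : ∀ x σ c → c ≢ [] →
  peaks (x ∷ σ) ≡ partialSums 0 c → length (x ∷ σ) ≡ sum c → peakComp (x ∷ σ) ≡ c
partialSums⇒peakComp x σ c c≢[] peaks≡ length≡ = trans (cong₂ (diffs 0) peaks≡ length≡) (partialSums⇒diffs 0 c c≢[])

filter-below : ∀ B {xs ys} → All (_< B) xs → All (B ≤_) ys → filter (_<? B) (xs ++ ys) ≡ xs
filter-below B {xs} {ys} below above = begin
    filter (_<? B) (xs ++ ys)                   ≡⟨ filter-++ (_<? B) xs ys ⟩
    filter (_<? B) xs ++ filter (_<? B) ys      ≡⟨ cong₂ _++_ (filter-all (_<? B) below) (filter-none (_<? B) (mapAll ≤⇒≯ above)) ⟩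
    xs ++ []                                    ≡⟨ ++-identityʳ xs ⟩
    xs                                          ∎
  where open ≡-Reasoning

filter-above : ∀ K {xs ys} → All (_< K) xs → All (K ≤_) ys → filter (K ≤?_) (xs ++ ys) ≡ ys
filter-above K {xs} {ys} below above = begin
    filter (K ≤?_) (xs ++ ys)                   ≡⟨ filter-++ (K ≤?_) xs ys ⟩
    filter (K ≤?_) xs ++ filter (K ≤?_) ys      ≡⟨ cong₂ _++_ (filter-none (K ≤?_) (mapAll <⇒≱ below)) (filter-all (K ≤?_) above) ⟩
    ys                                          ∎
  where open ≡-Reasoning

separate : ∀ B K → B ≤ K → ∀ {xs ys zs us vs} → xs ++ ys ++ zs ≡ us ++ vs →
  All (_< B) xs → All (_< B) us → All (B ≤_) ys → All (_< K) ys → All (K ≤_) zs → All (K ≤_) vs →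
  xs ≡ us × zs ≡ vs
separate B K B≤K {xs} {ys} {zs} {us} {vs} eq xs<B us<B B≤ys ys<K K≤zs K≤vs =
  (begin
    xs                                ≡⟨ sym (filter-below B xs<B (All.++⁺ B≤ys (mapAll (≤-trans B≤K) K≤zs))) ⟩
    filter (_<? B) (xs ++ ys ++ zs)   ≡⟨ cong (filter (_<? B)) eq ⟩
    filter (_<? B) (us ++ vs)         ≡⟨ filter-below B us<B (mapAll (≤-trans B≤K) K≤vs) ⟩
    us                                ∎) ,
  (begin
    zs                                ≡⟨ sym (filter-above K (All.++⁺ (mapAll below-K xs<B) ys<K) K≤zs) ⟩
    filter (K ≤?_) ((xs ++ ys) ++ zs) ≡⟨ cong (filter (K ≤?_)) (trans (++-assoc xs ys zs) eq) ⟩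
    filter (K ≤?_) (us ++ vs)         ≡⟨ filter-above K (mapAll below-K us<B) K≤vs ⟩
    vs                                ∎)
  where
    open ≡-Reasoning
    below-K : ∀ {x} → x < B → x < K
    below-K x<B = <-≤-trans x<B B≤K

peaks-++ : ∀ L r₁ r₂ R → peaks (L ++ r₁ ∷ r₂ ∷ R)
  ≡ peaks L ++ seamPeaks 2 L r₁ r₂ ++ map (length L +_) (peaks (r₁ ∷ r₂ ∷ R))
peaks-++ L r₁ r₂ R =
  trans (peaksFrom-++ 2 L r₁ r₂ R)
        (cong (λ ps → peaks L ++ seamPeaks 2 L r₁ r₂ ++ ps) (peaksFrom-shift (length L) 2 (r₁ ∷ r₂ ∷ R)))

partialSums-a3b : ∀ a d b → partialSums 0 (a ++ 3 ∷ d ∷ b)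
  ≡ partialSums 0 (a ++ 1 ∷ []) ++ map (sum a + 1 +_) (partialSums 0 (2 ∷ d ∷ b))
partialSums-a3b a d b = trans (partialSums-split 0 a 1 2 d b)
  (cong (partialSums 0 (a ++ 1 ∷ []) ++_) (trans (cong (λ k → partialSums k (2 ∷ d ∷ b)) (sym (+-identityʳ (sum a + 1))))
                                                 (partialSums-shift (sum a + 1) 0 (2 ∷ d ∷ b))))

peakAt2⇒ascent : ∀ r₁ r₂ R {ps} → peaks (r₁ ∷ r₂ ∷ R) ≡ 2 ∷ ps → r₁ < r₂
peakAt2⇒ascent r₁ r₂ (r₃ ∷ R) {ps} eq with r₁ <? r₂
... | yes r₁<r₂ = r₁<r₂
... | no  r₁≮r₂ =
  ⊥-elim (<-irrefl refl (proj₁ (lookup (peaksFrom-bounds 3 (r₂ ∷ r₃ ∷ R)) (subst (2 ∈_) (sym no-first-peak) (here refl)))))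
  where
    no-first-peak : peaksFrom 3 (r₂ ∷ r₃ ∷ R) ≡ 2 ∷ ps
    no-first-peak = trans (sym (cong (λ b → markIf 2 b ++ peaksFrom 3 (r₂ ∷ r₃ ∷ R)) (isPeak-no-left r₁ r₂ r₃ r₁≮r₂)))
                          (trans (sym (peaksFrom-step 2 r₁ r₂ r₃ R)) eq)

endsDescending-a1 : ∀ a L → length L ≡ sum a + 1 → peaks L ≡ partialSums 0 (a ++ 1 ∷ []) → EndsDescending L
endsDescending-a1 a        []           |L|≡  _      = ⊥-elim (m+1+n≢0 (sum a) (sym |L|≡))
endsDescending-a1 a        (x ∷ [])     _     _      = tt
endsDescending-a1 []       (x ∷ y ∷ L) ()    _
endsDescending-a1 (c ∷ a) (x ∷ y ∷ L) |L|≡  peaks≡ =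
  lastPeak⇒EndsDescending 2 (x ∷ y ∷ L) (subst (_ ∈_) (sym peaks≡) (partialSums-last 0 c a 1))
    (trans (cong (_+ 2) |L|≡) (trans (+-assoc (sum (c ∷ a)) 1 2) (+-comm (sum (c ∷ a)) 3)))

peaks-bounds : ∀ w → All (λ m → 2 ≤ m × m < length w) (peaks w)
peaks-bounds w = mapAll (λ {m} (2≤m , m+3≤) →
                           2≤m , +-cancelʳ-≤ 2 (suc m) (length w) (subst (_≤ length w + 2) (cong suc (+-comm 2 m)) m+3≤))
                        (peaksFrom-bounds 2 w)

module PeakSplit (a : List ℕ) (d : ℕ) (b : List ℕ) (pos-a : All (0 <_) a) where

  c c₁ c₂ : List ℕ
  c  = a ++ 3 ∷ d ∷ b
  c₁ = a ++ 1 ∷ []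
  c₂ = 2 ∷ d ∷ b

  l : ℕ
  l = sum a + 1

  length-c₁ : sum c₁ ≡ l
  length-c₁ = sum-++ a (1 ∷ [])

  peakComp-split⇒ : ∀ L R → length L ≡ l → length R ≡ sum c₂ →
    peakComp (L ++ R) ≡ c → peakComp L ≡ c₁ × peakComp R ≡ c₂
  peakComp-split⇒ []       R              |L|≡l _  _   = ⊥-elim (m+1+n≢0 (sum a) (sym |L|≡l))
  peakComp-split⇒ (x ∷ L′) (r₁ ∷ r₂ ∷ R′) |L|≡l |R|≡ pc≡ =
    partialSums⇒peakComp x L′ c₁ (++-∷≢[] a) (proj₁ parts) (trans |L|≡l (sym length-c₁)) ,
    partialSums⇒peakComp r₁ (r₂ ∷ R′) c₂ ∷≢[] (map-injective (λ {x} {y} → +-cancelˡ-≡ l x y) (proj₂ parts)) |R|≡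
    where
      L R : List ℕ
      L = x ∷ L′
      R = r₁ ∷ r₂ ∷ R′
      decomposition : peaks L ++ seamPeaks 2 L r₁ r₂ ++ map (l +_) (peaks R) ≡ partialSums 0 c₁ ++ map (l +_) (partialSums 0 c₂)
      decomposition = begin
          peaks L ++ seamPeaks 2 L r₁ r₂ ++ map (l +_) (peaks R)
        ≡⟨ cong (λ k → peaks L ++ seamPeaks 2 L r₁ r₂ ++ map (k +_) (peaks R)) (sym |L|≡l) ⟩
          peaks L ++ seamPeaks 2 L r₁ r₂ ++ map (length L +_) (peaks R)
        ≡⟨ sym (peaks-++ L r₁ r₂ R′) ⟩
          peaks (L ++ R)
        ≡⟨ proj₁ (peakComp⇒partialSums x (L′ ++ R) c pc≡) ⟩
          partialSums 0 c
        ≡⟨ partialSums-a3b a d b ⟩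
          partialSums 0 c₁ ++ map (l +_) (partialSums 0 c₂) ∎
        where open ≡-Reasoning
      seam-bounds : ∀ {m} → m ∈ seamPeaks 2 L r₁ r₂ → l ≤ m × m < l + 2
      seam-bounds {m} m∈ with seamPeaks-bounds 2 L r₁ r₂ m∈
      ... | lower , upper = subst (_≤ m) |L|≡l (+-cancelʳ-≤ 2 (length L) m (subst (length L + 2 ≤_) (+-comm 2 m) lower)) ,
                            subst (λ k → m < k + 2) |L|≡l upper
      parts : peaks L ≡ partialSums 0 c₁ × map (l +_) (peaks R) ≡ map (l +_) (partialSums 0 c₂)
      parts = separate l (l + 2) (m≤m+n l 2) decomposition
        (mapAll (λ {m} (_ , m<|L|) → subst (m <_) |L|≡l m<|L|) (peaks-bounds L))
        (tabulate (λ {m} m∈ → subst (m <_) length-c₁ (partialSums-< 0 c₁ (All.++⁺ pos-a (s≤s z≤n ∷ [])) m∈)))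
        (tabulate (λ m∈ → proj₁ (seam-bounds m∈)))
        (tabulate (λ m∈ → proj₂ (seam-bounds m∈)))
        (All.map⁺ (mapAll (λ (2≤m , _) → +-monoʳ-≤ l 2≤m) (peaks-bounds R)))
        (All.map⁺ (tabulate (λ m∈ → +-monoʳ-≤ l (partialSums-≥ 0 2 (d ∷ b) m∈))))

  peakComp-split⇐ : ∀ L R → length L ≡ l → length R ≡ sum c₂ →
    peakComp L ≡ c₁ → peakComp R ≡ c₂ → peakComp (L ++ R) ≡ c
  peakComp-split⇐ []       R              |L|≡l _ _ _ = ⊥-elim (m+1+n≢0 (sum a) (sym |L|≡l))
  peakComp-split⇐ (x ∷ L′) (r₁ ∷ r₂ ∷ R′) |L|≡l |R|≡ pcL pcR =
    partialSums⇒peakComp x (L′ ++ R) c (++-∷≢[] a) peaks≡ length≡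
    where
      L R : List ℕ
      L = x ∷ L′
      R = r₁ ∷ r₂ ∷ R′
      peaksL : peaks L ≡ partialSums 0 c₁
      peaksL = proj₁ (peakComp⇒partialSums x L′ c₁ pcL)
      peaksR : peaks R ≡ partialSums 0 c₂
      peaksR = proj₁ (peakComp⇒partialSums r₁ (r₂ ∷ R′) c₂ pcR)
      no-seam : seamPeaks 2 L r₁ r₂ ≡ []
      no-seam = seamPeaks-empty 2 L r₁ r₂ (endsDescending-a1 a L |L|≡l peaksL) (peakAt2⇒ascent r₁ r₂ R′ peaksR)
      peaks≡ : peaks (L ++ R) ≡ partialSums 0 c
      peaks≡ = begin
          peaks (L ++ R)
        ≡⟨ peaks-++ L r₁ r₂ R′ ⟩
          peaks L ++ seamPeaks 2 L r₁ r₂ ++ map (length L +_) (peaks R)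
        ≡⟨ cong₂ _++_ peaksL (cong₂ (λ seam k → seam ++ map (k +_) (peaks R)) no-seam |L|≡l) ⟩
          partialSums 0 c₁ ++ map (l +_) (peaks R)
        ≡⟨ cong (λ ps → partialSums 0 c₁ ++ map (l +_) ps) peaksR ⟩
          partialSums 0 c₁ ++ map (l +_) (partialSums 0 c₂)
        ≡⟨ sym (partialSums-a3b a d b) ⟩
          partialSums 0 c ∎
        where open ≡-Reasoning
      length≡ : length (L ++ R) ≡ sum c
      length≡ = begin
          length (L ++ R)         ≡⟨ length-++ L ⟩
          length L + length R     ≡⟨ cong₂ _+_ |L|≡l |R|≡ ⟩
          sum a + 1 + sum c₂      ≡⟨ +-assoc (sum a) 1 (sum c₂) ⟩
          sum a + sum (3 ∷ d ∷ b) ≡⟨ sym (sum-++ a (3 ∷ d ∷ b)) ⟩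
          sum c                   ∎
        where open ≡-Reasoning

  peakComp-splits : SplitsAs l (sum c₂) (λ σ → peakComp σ ≡ c) (λ σ → peakComp σ ≡ c₁) (λ σ → peakComp σ ≡ c₂)
  peakComp-splits L R |L|≡l |R|≡ =
    mk⇔ (peakComp-split⇒ L R |L|≡l |R|≡) (λ (pcL , pcR) → peakComp-split⇐ L R |L|≡l |R|≡ pcL pcR)

hasPeakComp? : ∀ c → Decidable (λ σ → peakComp σ ≡ c)
hasPeakComp? c σ = ≡-dec _≟_ (peakComp σ) c

lemma5p1 : (a b : List ℕ) → All (0 <_) a → All (0 <_) b → b ≢ [] →
    P (a ++ (3 ∷ []) ++ b)
      ≡ ((sum a + sum b + 3) C (sum a + 1)) * P (a ++ (1 ∷ [])) * P (2 ∷ b)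
lemma5p1 a []      _     _ b≢[] = ⊥-elim (b≢[] refl)
lemma5p1 a (d ∷ b) pos-a _ _    = begin
    #perms (hasPeakComp? c) (sum c)
  ≡⟨ cong (#perms (hasPeakComp? c)) |c|≡l+r ⟩
    #perms (hasPeakComp? c) (l + r)
  ≡⟨ shuffle-count ⟩
    ((l + r) C l) * #perms (hasPeakComp? c₁) l * #perms (hasPeakComp? c₂) r
  ≡⟨ cong₂ (λ n k → (n C l) * #perms (hasPeakComp? c₁) k * #perms (hasPeakComp? c₂) r) (sym |a|+|b|+3≡l+r) (sym length-c₁) ⟩
    ((sum a + sum (d ∷ b) + 3) C l) * #perms (hasPeakComp? c₁) (sum c₁) * #perms (hasPeakComp? c₂) r ∎
  where
    open ≡-Reasoning
    open PeakSplit a d b pos-a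
    r : ℕ
    r = sum c₂
    open Shuffle l r (hasPeakComp? c) (hasPeakComp? c₁) (hasPeakComp? c₂)
                 peakComp-splits (peakComp-invariant c₁) (peakComp-invariant c₂)
    |c|≡l+r : sum c ≡ l + r
    |c|≡l+r = trans (sum-++ a (3 ∷ d ∷ b)) (sym (+-assoc (sum a) 1 r))
    |a|+|b|+3≡l+r : sum a + sum (d ∷ b) + 3 ≡ l + r
    |a|+|b|+3≡l+r = trans (+-assoc (sum a) (sum (d ∷ b)) 3)
                      (trans (cong (sum a +_) (+-comm (sum (d ∷ b)) 3)) (sym (+-assoc (sum a) 1 r)))
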